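{- Let $T$ be a diagram of shape $\lambda$, where $\lambda$ is a Young diagram. The following are equivalent: (1) $T$ is an X-diagram; (2) for every rectangular submatrix $M$ of $T$, any two rows of $M$ having the same number of 1s are equal; (3) for every rectangular submatrix of $T$ having two rows, the set of column indices of the 1s in the first row contains, or is contained in, the set of column indices of the 1s in the second row; (4) for every rectangular submatrix $M$ of $T$: if an entry of $M$ is 0 and lies in a row of $M$ having the maximal number of 1s among the rows of $M$, then this entry lies in a column of $M$ consisting only of 0s.
   Context: A Young diagram $\lambda$ is drawn in English notation (rows numbered top to bottom, left-justified, weakly decreasing lengths), cells $(i,j)$. A diagram of shape $\lambda$ is a filling of its cells with 0s and 1s. A rectangular submatrix of $T$ is obtained by choosing row indices $i_1<\dots<i_p$ and column indices $j_1<\dots<j_q$ such that all cells $(i_a,j_b)$ lie in $\lambda$, and taking the $p\times q$ matrix of the corresponding entries. A diagram avoids a $2\times2$ pattern $P$ if no $2\times 2$ rectangular submatrix equals $P$. An X-diagram is a diagram avoiding $\begin{pmatrix}1&0\\0&1\end{pmatrix}$ and $\begin{pmatrix}0&1\\1&0\end{pmatrix}$. -}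

module Defs where

open import Data.Nat using (ℕ; zero; suc; _+_; _<_; _≤_; _≥_)
open import Data.Bool using (Bool; true; false; if_then_else_)
open import Data.List using (List; []; _∷_)
open import Data.List.Relation.Unary.Linked using (Linked)
open import Data.Fin using (Fin; zero; suc) renaming (_<_ to _<ᶠ_)
open import Data.Vec using (Vec; lookup)
open import Data.Product using (_×_)
open import Data.Sum using (_⊎_)
open import Relation.Binary.PropositionalEquality using (_≡_)
open import Relation.Nullary using (¬_)

-- A Young diagram (partition) given by its row lengths, top to bottom,
-- weakly decreasing.
YoungDiagram : List ℕ → Set
YoungDiagram sh = Linked _≥_ sh

-- length of row i (0-indexed); 0 for rows beyond the diagram
rowLen : List ℕ → ℕ → ℕ
rowLen []       _       = 0
rowLen (l ∷ _)  zero    = l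
rowLen (_ ∷ ls) (suc i) = rowLen ls i

InShape : List ℕ → ℕ → ℕ → Set
InShape sh i j = j < rowLen sh i

-- A diagram (filling of the cells with 0/1, encoded as false/true).
-- Values outside the shape are irrelevant: every condition below only
-- inspects cells lying in the shape.
Diagram : Set
Diagram = ℕ → ℕ → Bool

Increasing : ∀ {n} → Vec ℕ n → Set
Increasing {n} v = (a b : Fin n) → a <ᶠ b → lookup v a < lookup v b

IsRect : List ℕ → ∀ {p q} → Vec ℕ p → Vec ℕ q → Set
IsRect sh {p} {q} rs cs =
  Increasing rs × Increasing cs × ((a : Fin p) (b : Fin q) → InShape sh (lookup rs a) (lookup cs b))

sub : Diagram → ∀ {p q} → Vec ℕ p → Vec ℕ q → Fin p → Fin q → Bool
sub T rs cs a b = T (lookup rs a) (lookup cs b)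

_≐_ : ∀ {p q} → (Fin p → Fin q → Bool) → (Fin p → Fin q → Bool) → Set
_≐_ {p} {q} M N = (a : Fin p) (b : Fin q) → M a b ≡ N a b

countOnes : ∀ {q} → (Fin q → Bool) → ℕ
countOnes {zero}  r = 0
countOnes {suc q} r = (if r zero then 1 else 0) + countOnes (λ b → r (suc b))

P₁ : Fin 2 → Fin 2 → Bool
P₁ zero       zero       = true
P₁ zero       (suc zero) = false
P₁ (suc zero) zero       = false
P₁ (suc zero) (suc zero) = true

P₂ : Fin 2 → Fin 2 → Bool
P₂ zero       zero       = false
P₂ zero       (suc zero) = true
P₂ (suc zero) zero       = true
P₂ (suc zero) (suc zero) = false

Avoids : List ℕ → Diagram → (Fin 2 → Fin 2 → Bool) → Set
Avoids sh T P = (rs cs : Vec ℕ 2) → IsRect sh rs cs → ¬ (sub T rs cs ≐ P)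

IsXDiagram : List ℕ → Diagram → Set
IsXDiagram sh T = Avoids sh T P₁ × Avoids sh T P₂

Cond2 : List ℕ → Diagram → Set
Cond2 sh T = ∀ {p q} (rs : Vec ℕ p) (cs : Vec ℕ q) → IsRect sh rs cs →
  (a a' : Fin p) → countOnes (sub T rs cs a) ≡ countOnes (sub T rs cs a') →
  (b : Fin q) → sub T rs cs a b ≡ sub T rs cs a' b

OnesSubset : ∀ {q} → (Fin q → Bool) → (Fin q → Bool) → Set
OnesSubset {q} r r' = (b : Fin q) → r b ≡ true → r' b ≡ true

Cond3 : List ℕ → Diagram → Set
Cond3 sh T = ∀ {q} (rs : Vec ℕ 2) (cs : Vec ℕ q) → IsRect sh rs cs →
  OnesSubset (sub T rs cs zero) (sub T rs cs (suc zero))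
  ⊎ OnesSubset (sub T rs cs (suc zero)) (sub T rs cs zero)

Cond4 : List ℕ → Diagram → Set
Cond4 sh T = ∀ {p q} (rs : Vec ℕ p) (cs : Vec ℕ q) → IsRect sh rs cs →
  (a : Fin p) (b : Fin q) → sub T rs cs a b ≡ false →
  ((a' : Fin p) → countOnes (sub T rs cs a') ≤ countOnes (sub T rs cs a)) →
  (a' : Fin p) → sub T rs cs a' b ≡ false

module Submission where

-- Call two 0/1 rows r, r' NESTED if the set of positions of the
-- 1s of one is contained in that of the other, and call two columns b, b' a
-- CROSSING of r and r' if column b has a 1 in r and a 0 in r', while column
-- b' has a 1 in r' and a 0 in r.  Two rows are nested unless they have a
-- crossing, and a crossing of two rows of a rectangular submatrix is exactly
-- a 2×2 rectangular submatrix equal to one of the two patterns (which one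
-- depends on the order of the columns).
--   * Forward directions: in an X-diagram every two rows of every rectangular
--     submatrix are nested.  Conditions (2), (3), (4) are then consequences
--     of general facts about nested rows: nested rows with equally many 1s
--     are equal, and a 0 of a row with the most 1s is a 0 in every row
--     nested with it.
--   * Backward directions: a 2×2 submatrix equal to a pattern has crossing
--     rows with equally many 1s, which each of (2), (3), (4) rules out.

open import Defs
open import Data.Nat using (ℕ; _<_; _≤_; z≤n; s≤s)
open import Data.Nat.Properties
  using (≤-refl; ≤-reflexive; ≤-antisym; <-irrefl; ≤⇒≯; +-mono-≤; +-mono-<-≤; +-mono-≤-<)
open import Data.Bool using (Bool; true; false; if_then_else_)
open import Data.List using (List)
open import Data.Vec using (Vec; _∷_; []; lookup)
open import Data.Vec.Functional using (tail)
open import Data.Fin using (Fin; zero; suc) renaming (_<_ to _<ᶠ_)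
open import Data.Fin.Properties using (<-cmp)
open import Data.Product using (_×_; _,_; ∃; ∃₂)
open import Data.Sum using (_⊎_; inj₁; inj₂; swap)
open import Data.Empty using (⊥-elim)
open import Relation.Binary using (tri<; tri≈; tri>)
open import Relation.Binary.PropositionalEquality using (_≡_; _≢_; refl; sym; trans)
open import Relation.Nullary using (¬_)
open import Function.Bundles using (_⇔_; mk⇔)

true≢false : true ≢ false
true≢false ()

Row : ℕ → Set
Row q = Fin q → Bool

bit-mono : ∀ {x y : Bool} → (x ≡ true → y ≡ true) →
           (if x then 1 else 0) ≤ (if y then 1 else 0)
bit-mono {false} {_}     _ = z≤n
bit-mono {true}  {true}  _ = ≤-refl
bit-mono {true}  {false} x⇒y with () ← x⇒y refl

count-mono : ∀ {q} (r r' : Row q) → OnesSubset r r' → countOnes r ≤ countOnes r'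
count-mono {ℕ.zero}  r r' r⊆r' = z≤n
count-mono {ℕ.suc q} r r' r⊆r' =
  +-mono-≤ (bit-mono (r⊆r' zero)) (count-mono (tail r) (tail r') (λ b → r⊆r' (suc b)))

count-strict : ∀ {q} (r r' : Row q) → OnesSubset r r' →
               (b : Fin q) → r b ≡ false → r' b ≡ true → countOnes r < countOnes r'
count-strict r r' r⊆r' zero rb≡0 r'b≡1 rewrite rb≡0 | r'b≡1 =
  +-mono-<-≤ (s≤s z≤n) (count-mono (tail r) (tail r') (λ b → r⊆r' (suc b)))
count-strict r r' r⊆r' (suc b) rb≡0 r'b≡1 =
  +-mono-≤-< (bit-mono (r⊆r' zero)) (count-strict (tail r) (tail r') (λ b → r⊆r' (suc b)) b rb≡0 r'b≡1)

count-cong : ∀ {q} (r r' : Row q) → ((b : Fin q) → r b ≡ r' b) → countOnes r ≡ countOnes r'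
count-cong r r' r≡r' =
  ≤-antisym (count-mono r r' (λ b rb≡1 → trans (sym (r≡r' b)) rb≡1))
            (count-mono r' r (λ b r'b≡1 → trans (r≡r' b) r'b≡1))

Nested : ∀ {q} → Row q → Row q → Set
Nested r r' = OnesSubset r r' ⊎ OnesSubset r' r

Separates : ∀ {q} → Row q → Row q → Fin q → Set
Separates r r' b = r b ≡ true × r' b ≡ false

Crossing : ∀ {q} → Row q → Row q → Fin q → Fin q → Set
Crossing r r' b b' = Separates r r' b × Separates r' r b'

subset-or-separated : ∀ {q} (r r' : Row q) → OnesSubset r r' ⊎ ∃ (Separates r r')
subset-or-separated {ℕ.zero} r r' = inj₁ (λ ())
subset-or-separated {ℕ.suc q} r r'
  with r zero in r0 | r' zero in r'0 | subset-or-separated (tail r) (tail r')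
... | true  | false | _                 = inj₂ (zero , r0 , r'0)
... | _     | _     | inj₂ (b , sep)    = inj₂ (suc b , sep)
... | true  | true  | inj₁ tail⊆       = inj₁ λ { zero _ → r'0 ; (suc b) → tail⊆ b }
... | false | _     | inj₁ tail⊆       =
  inj₁ λ { zero r0≡1 → ⊥-elim (true≢false (trans (sym r0≡1) r0)) ; (suc b) → tail⊆ b }

separated-not-subset : ∀ {q} {r r' : Row q} {b : Fin q} →
                       Separates r r' b → ¬ OnesSubset r r'
separated-not-subset (rb≡1 , r'b≡0) r⊆r' = true≢false (trans (sym (r⊆r' _ rb≡1)) r'b≡0)

crossing-not-nested : ∀ {q} {r r' : Row q} {b b' : Fin q} → Crossing r r' b b' → ¬ Nested r r'
crossing-not-nested (sep , _)  (inj₁ r⊆r') = separated-not-subset sep r⊆r'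
crossing-not-nested (_ , sep') (inj₂ r'⊆r) = separated-not-subset sep' r'⊆r

nested-unless-crossing : ∀ {q} (r r' : Row q) →
                         (∀ {b b'} → ¬ Crossing r r' b b') → Nested r r'
nested-unless-crossing r r' noCrossing
  with subset-or-separated r r' | subset-or-separated r' r
... | inj₁ r⊆r' | _           = inj₁ r⊆r'
... | _         | inj₁ r'⊆r   = inj₂ r'⊆r
... | inj₂ (_ , sep) | inj₂ (_ , sep') = ⊥-elim (noCrossing (sep , sep'))

nested-equal-count : ∀ {q} (r r' : Row q) → Nested r r' →
                     countOnes r ≡ countOnes r' → (b : Fin q) → r b ≡ r' b
nested-equal-count r r' nested count≡ b with r b in rb | r' b in r'b | nested
... | true  | true  | _          = refl
... | false | false | _          = refl
... | true  | false | inj₁ r⊆r'  = ⊥-elim (separated-not-subset (rb , r'b) r⊆r')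
... | false | true  | inj₂ r'⊆r  = ⊥-elim (separated-not-subset (r'b , rb) r'⊆r)
... | true  | false | inj₂ r'⊆r  =
  ⊥-elim (<-irrefl (sym count≡) (count-strict r' r r'⊆r b r'b rb))
... | false | true  | inj₁ r⊆r'  = ⊥-elim (<-irrefl count≡ (count-strict r r' r⊆r' b rb r'b))

nested-maximal-zero : ∀ {q} (r r' : Row q) → Nested r r' → countOnes r' ≤ countOnes r →
                      (b : Fin q) → r b ≡ false → r' b ≡ false
nested-maximal-zero r r' nested r'≤r b rb≡0 with r' b in r'b | nested
... | false | _         = refl
... | true  | inj₁ r⊆r' = ⊥-elim (≤⇒≯ r'≤r (count-strict r r' r⊆r' b rb≡0 r'b))
... | true  | inj₂ r'⊆r = ⊥-elim (true≢false (trans (sym (r'⊆r b r'b)) rb≡0))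

crossing⇒P₁ : (M : Fin 2 → Fin 2 → Bool) →
              Crossing (M zero) (M (suc zero)) zero (suc zero) → M ≐ P₁
crossing⇒P₁ M ((m00 , m10) , (m11 , m01)) =
  λ { zero zero → m00 ; zero (suc zero) → m01 ; (suc zero) zero → m10 ; (suc zero) (suc zero) → m11 }

crossing⇒P₂ : (M : Fin 2 → Fin 2 → Bool) →
              Crossing (M zero) (M (suc zero)) (suc zero) zero → M ≐ P₂
crossing⇒P₂ M ((m01 , m11) , (m10 , m00)) =
  λ { zero zero → m00 ; zero (suc zero) → m01 ; (suc zero) zero → m10 ; (suc zero) (suc zero) → m11 }

-- The two rows of a 2×2 matrix cross and have equally many 1s; both
-- patterns have this property.
BalancedCrossing : (Fin 2 → Fin 2 → Bool) → Set
BalancedCrossing M = countOnes (M zero) ≡ countOnes (M (suc zero)) × ∃₂ (Crossing (M zero) (M (suc zero)))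

balanced-crossing-cong : (M P : Fin 2 → Fin 2 → Bool) → M ≐ P → BalancedCrossing P → BalancedCrossing M
balanced-crossing-cong M P M≐P (count≡ , b , b' , (p0b , p1b) , (p1b' , p0b')) =
  trans (count-cong (M zero) (P zero) (M≐P zero))
        (trans count≡ (sym (count-cong (M (suc zero)) (P (suc zero)) (M≐P (suc zero)))))
  , b , b' , (trans (M≐P zero b) p0b , trans (M≐P (suc zero) b) p1b)
           , (trans (M≐P (suc zero) b') p1b' , trans (M≐P zero b') p0b')

pair-increasing : ∀ {i i'} → i < i' → Increasing (i ∷ i' ∷ [])
pair-increasing i<i' zero       (suc zero) _          = i<i'
pair-increasing i<i' (suc zero) (suc zero) (s≤s ())

minor : ∀ {n} → Vec ℕ n → Fin n → Fin n → Vec ℕ 2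
minor v a a' = lookup v a ∷ lookup v a' ∷ []

minor-rect : ∀ (sh : List ℕ) {p q} (rs : Vec ℕ p) (cs : Vec ℕ q) → IsRect sh rs cs →
             ∀ {a a' b b'} → a <ᶠ a' → b <ᶠ b' → IsRect sh (minor rs a a') (minor cs b b')
minor-rect sh rs cs (rs↑ , cs↑ , inShape) {a} {a'} {b} {b'} a<a' b<b' =
  pair-increasing (rs↑ a a' a<a') , pair-increasing (cs↑ b b' b<b') ,
  λ { zero zero → inShape a b ; zero (suc zero) → inShape a b'
    ; (suc zero) zero → inShape a' b ; (suc zero) (suc zero) → inShape a' b' }

module _ (sh : List ℕ) (T : Diagram) where

  -- In an X-diagram no two rows of a rectangular submatrix cross: the
  -- crossing would be a 2×2 submatrix equal to P₁ or P₂.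
  no-crossing : IsXDiagram sh T → ∀ {p q} (rs : Vec ℕ p) (cs : Vec ℕ q) → IsRect sh rs cs →
                ∀ {a a'} → a <ᶠ a' → ∀ {b b'} → ¬ Crossing (sub T rs cs a) (sub T rs cs a') b b'
  no-crossing (avoid₁ , avoid₂) rs cs rect {a} {a'} a<a' {b} {b'} crossing@((rab≡1 , _) , (_ , rab≡0)) with <-cmp b b'
  ... | tri< b<b' _ _ =
    avoid₁ (minor rs a a') (minor cs b b') (minor-rect sh rs cs rect a<a' b<b')
           (crossing⇒P₁ (sub T (minor rs a a') (minor cs b b')) crossing)
  ... | tri> _ _ b'<b =
    avoid₂ (minor rs a a') (minor cs b' b) (minor-rect sh rs cs rect a<a' b'<b)
           (crossing⇒P₂ (sub T (minor rs a a') (minor cs b' b)) crossing)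
  ... | tri≈ _ refl _ = true≢false (trans (sym rab≡1) rab≡0)

  rows-nested : IsXDiagram sh T → ∀ {p q} (rs : Vec ℕ p) (cs : Vec ℕ q) → IsRect sh rs cs →
                (a a' : Fin p) → Nested (sub T rs cs a) (sub T rs cs a')
  rows-nested X rs cs rect a a' with <-cmp a a'
  ... | tri≈ _ refl _ = inj₁ (λ _ rb≡1 → rb≡1)
  ... | tri< a<a' _ _ = nested-unless-crossing _ _ (no-crossing X rs cs rect a<a')
  ... | tri> _ _ a'<a = swap (nested-unless-crossing _ _ (no-crossing X rs cs rect a'<a))

  X-if-no-balanced-crossing :
    (∀ (rs cs : Vec ℕ 2) → IsRect sh rs cs → ¬ BalancedCrossing (sub T rs cs)) →
                  IsXDiagram sh T
  X-if-no-balanced-crossing noBalancedCrossing =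
      (λ rs cs rect M≐P₁ → noBalancedCrossing rs cs rect
         (balanced-crossing-cong (sub T rs cs) P₁ M≐P₁ (refl , zero , suc zero , (refl , refl) , (refl , refl))))
    , (λ rs cs rect M≐P₂ → noBalancedCrossing rs cs rect
         (balanced-crossing-cong (sub T rs cs) P₂ M≐P₂ (refl , suc zero , zero , (refl , refl) , (refl , refl))))

  -- (1) ⇒ (2): rows of a submatrix are nested, so equal counts force equality.
  X⇒2 : IsXDiagram sh T → Cond2 sh T
  X⇒2 X rs cs rect a a' = nested-equal-count _ _ (rows-nested X rs cs rect a a')

  -- (2) ⇒ (1): crossing rows with equal counts would have to be equal.
  2⇒X : Cond2 sh T → IsXDiagram sh T
  2⇒X cond2 = X-if-no-balanced-crossing λ { rs cs rect (count≡ , b , _ , (m0b , m1b) , _) →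
    true≢false (trans (sym m0b) (trans (cond2 rs cs rect zero (suc zero) count≡ b) m1b)) }

  X⇒3 : IsXDiagram sh T → Cond3 sh T
  X⇒3 X rs cs rect = rows-nested X rs cs rect zero (suc zero)

  3⇒X : Cond3 sh T → IsXDiagram sh T
  3⇒X cond3 = X-if-no-balanced-crossing λ { rs cs rect (_ , _ , _ , crossing) →
    crossing-not-nested crossing (cond3 rs cs rect) }

  -- (1) ⇒ (4): a 0 in a row with the most 1s is a 0 in every row nested with it.
  X⇒4 : IsXDiagram sh T → Cond4 sh T
  X⇒4 X rs cs rect a b entry≡0 maximal a' =
    nested-maximal-zero _ _ (rows-nested X rs cs rect a a') (maximal a') b entry≡0

  -- (4) ⇒ (1): in a balanced crossing the first row has the most 1s, and its
  -- 0 at the second crossing column faces a 1 in the second row.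
  4⇒X : Cond4 sh T → IsXDiagram sh T
  4⇒X cond4 = X-if-no-balanced-crossing λ { rs cs rect (count≡ , _ , b' , _ , (m1b' , m0b')) →
    true≢false (trans (sym m1b')
      (cond4 rs cs rect zero b' m0b' (λ { zero → ≤-refl ; (suc zero) → ≤-reflexive (sym count≡) })
             (suc zero))) }

lemma2p1 : (sh : List ℕ) → YoungDiagram sh → (T : Diagram) →
    (IsXDiagram sh T ⇔ Cond2 sh T) × (IsXDiagram sh T ⇔ Cond3 sh T) × (IsXDiagram sh T ⇔ Cond4 sh T)
lemma2p1 sh _ T =
  mk⇔ (X⇒2 sh T) (2⇒X sh T) , mk⇔ (X⇒3 sh T) (3⇒X sh T) , mk⇔ (X⇒4 sh T) (4⇒X sh T)
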